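{- Let $P$ be a feasible packing of an instance of minsum bin packing (as in the context), and let $Q_P$ be the packing obtained from $P$ by removing all small items and repacking them with $NFI^{+}$ into the remaining space (as defined in the context). Then $\mathrm{Cost}(Q_P)\le\mathrm{Cost}(P)$.
   Context: Items have weights in $(0,1]$. A packing is a sequence of pairwise disjoint bins $B_1,B_2,\dots$ whose union is the item set; its cost is $\mathrm{Cost}=\sum_j j\,\lvert B_j\rvert$. It is feasible if each bin has total weight at most $1$. Fix $0<\epsilon\le1/4$ with $1/\epsilon$ an integer; an item is small if its weight is at most $\epsilon^2$, large otherwise. $Q_P$: keep every large item in the same bin as in $P$; then process the small items in non-decreasing order of weight, starting with bin $B_1$ as current bin, placing each item into the current bin, and moving to the next bin (index one larger) only after the total weight of the current bin's contents (large items included) strictly exceeds $1$ ($NFI^{+}$ rule).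
   Formalization: The item weights are rational numbers in (0,1]. -}

module Defs where

open import Data.Nat as ℕ using (ℕ; suc)
open import Data.Fin using (Fin; _≟_)
open import Data.List using (List; []; _∷_; foldr; map; allFin; filter)
open import Data.Bool using (if_then_else_)
open import Data.Rational as ℚ using (ℚ; 0ℚ; 1ℚ; _+_; _*_; _≤_; _<_; _≤?_; _<?_; 1/_)
open import Data.List.Membership.Propositional using (_∈_)
open import Data.List.Relation.Unary.Unique.Propositional using (Unique)
open import Data.List.Relation.Unary.Linked using (Linked)
open import Data.Product using (_×_)
open import Function.Bundles using (_⇔_)
open import Relation.Nullary.Decidable using (does; _×-dec_; ¬?)
open import Data.Nat.ListAction using (sum)
import Data.Nat.Properties
import Data.Integer as ℤ
open import Relation.Binary.PropositionalEquality using (_≡_)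

ValidWeights : (n : ℕ) → (Fin n → ℚ) → Set
ValidWeights n w = ∀ i → (0ℚ < w i) × (w i ≤ 1ℚ)

-- A packing assigns every item to a bin index j ≥ 1 (bin B_j = {i | P i ≡ j}).
-- This is exactly a sequence of pairwise disjoint bins whose union is the item set.
Packing : ℕ → Set
Packing n = Fin n → ℕ

ValidIndices : (n : ℕ) → Packing n → Set
ValidIndices n P = ∀ i → 1 ℕ.≤ P i

sumℚ : List ℚ → ℚ
sumℚ = foldr _+_ 0ℚ

-- Cost(P) = Σ_j j |B_j| = Σ_i (index of the bin of i).
Cost : (n : ℕ) → Packing n → ℕ
Cost n P = sum (map P (allFin n))

binWeight : (n : ℕ) → (Fin n → ℚ) → Packing n → ℕ → ℚ
binWeight n w P j = sumℚ (map w (filter (λ i → P i ℕ.≟ j) (allFin n)))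

Feasible : (n : ℕ) → (Fin n → ℚ) → Packing n → Set
Feasible n w P = ∀ j → binWeight n w P j ≤ 1ℚ

-- ε = 1 / k with k = 1/ε a positive integer; ε² = 1/(k*k).
epsSq : (k : ℕ) → .{{_ : ℕ.NonZero k}} → ℚ
epsSq k = ℚ._/_ (ℤ.+ 1) (k ℕ.* k)
  where instance _ = Data.Nat.Properties.m*n≢0 k k

Small : (k : ℕ) → .{{_ : ℕ.NonZero k}} → ℚ → Set
Small k x = x ≤ epsSq k

largeWeight : (n k : ℕ) → .{{_ : ℕ.NonZero k}} → (Fin n → ℚ) → Packing n → ℕ → ℚ
largeWeight n k w P j =
  sumℚ (map w (filter (λ i → (P i ℕ.≟ j) ×-dec (¬? (w i ≤? epsSq k))) (allFin n)))

-- NFI⁺ : given the current bin c and its current total weight cur,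
-- place the next small item into c; move to bin c+1 (whose content is then
-- its large items) only once the weight of c strictly exceeds 1.
-- Returns the new bin of each processed item; other items keep `base`.
nfi : (n : ℕ) → (Fin n → ℚ) → (ℕ → ℚ) → (Fin n → ℕ) →
      ℕ → ℚ → List (Fin n) → Fin n → ℕ
nfi n w L base c cur [] = base
nfi n w L base c cur (s ∷ ss) i =
  if does (i ≟ s) then c
  else (if does (1ℚ <? cur + w s)
        then nfi n w L base (suc c) (L (suc c)) ss i
        else nfi n w L base c (cur + w s) ss i)

QP : (n k : ℕ) → .{{_ : ℕ.NonZero k}} → (Fin n → ℚ) → Packing n → List (Fin n) → Packing n
QP n k w P order = nfi n w (largeWeight n k w P) P 1 (largeWeight n k w P 1) order

SmallOrder : (n k : ℕ) → .{{_ : ℕ.NonZero k}} → (Fin n → ℚ) → List (Fin n) → Set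
SmallOrder n k w order =
  Unique order × (∀ i → (i ∈ order) ⇔ Small k (w i)) × Linked (λ a b → w a ≤ w b) order

-- Only small items move, so it suffices to compare the sums, over the small items, of
-- their bin indices in Q_P and in P. A list of indices has no larger sum than another
-- of the same length as soon as, for every j, at least as many of its entries are ≤ j.
-- NFI⁺ takes the small items lightest first and leaves a bin only once it overflows, so
-- if it puts t small items into bins 1 … j without having packed them all, the t
-- lightest small items weigh more than the room the large items leave in bins 1 … j.
-- In P the small items of bins 1 … j fit into that room, so there are at most t of them.

module Submission where

open import Defs

open import Algebra.Properties.CommutativeSemigroup using (interchange)
open import Data.Bool using (true; false; if_then_else_)
open import Data.Bool.Properties using (if-cong)
open import Data.Fin using (Fin) renaming (_≟_ to _≟ᶠ_)
open import Data.List using (List; []; _∷_; _++_; map; filter; length; take; allFin)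
open import Data.List.Membership.Propositional using (_∈_; _∉_)
open import Data.List.Membership.Propositional.Properties using (∈-filter⁺; ∈-filter⁻; ∈-allFin)
open import Data.List.Membership.Propositional.Properties.WithK using (unique∧set⇒bag)
import Data.List.Membership.DecPropositional as DecMembership
open import Data.List.Properties
  using (map-++; map-cong-local; length-map; length-filter; filter-accept; filter-reject; filter-none; filter-≐)
open import Data.List.Relation.Binary.BagAndSetEquality using (∼bag⇒↭)
open import Data.List.Relation.Binary.Permutation.Propositional
  using (_↭_; ↭-refl; ↭-prep; ↭-trans; ↭-sym; ↭⇒↭ₛ)
open import Data.List.Relation.Binary.Permutation.Propositional.Properties
  using (shift; filter-↭; ++⁺ʳ) renaming (map⁺ to ↭-map⁺)
open import Data.List.Relation.Binary.Permutation.Setoid.Properties using (foldr-commMonoid)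
open import Data.List.Relation.Binary.Sublist.Propositional using (_⊆_; _∷_; _∷ʳ_)
open import Data.List.Relation.Binary.Sublist.Propositional.Properties
  using (Any-resp-⊆; ∷ˡ⁻; filter-⊆) renaming (map⁺ to ⊆-map⁺)
open import Data.List.Relation.Unary.All as All using (All; []; _∷_)
open import Data.List.Relation.Unary.All.Properties using (all-filter) renaming (map⁺ to All-map⁺)
open import Data.List.Relation.Unary.AllPairs using (AllPairs; []; _∷_)
open import Data.List.Relation.Unary.Any using (here; there)
open import Data.List.Relation.Unary.Linked using (Linked)
open import Data.List.Relation.Unary.Linked.Properties using (Linked⇒AllPairs) renaming (map⁺ to Linked-map⁺)
open import Data.List.Relation.Unary.Unique.Propositional using (Unique)
open import Data.List.Relation.Unary.Unique.Propositional.Properties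
  using (allFin⁺) renaming (filter⁺ to Unique-filter⁺)
open import Data.Nat as ℕ using (ℕ; NonZero; zero; suc; _≤_; _≰_; _<_; _⊓_; _≤?_; z≤n; s≤s)
import Data.Nat.Properties as ℕ
open import Data.Nat.ListAction using (sum)
open import Data.Nat.ListAction.Properties using (sum-↭; sum-++)
open import Data.Product using (_×_; _,_; proj₁; proj₂)
open import Data.Rational as ℚ using (ℚ; 0ℚ; 1ℚ; _-_)
  renaming (_≤_ to _≤ℚ_; _<_ to _<ℚ_; _+_ to _+ℚ_)
import Data.Rational.Properties as ℚ
open import Data.Rational.Solver using (module +-*-Solver)
open import Data.Sum using (_⊎_; inj₁; inj₂)
open import Function.Base using (_∘_)
open import Function.Bundles using (_⇔_; mk⇔; Equivalence)
open import Function.Construct.Identity using (⇔-id)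
open import Level using (Level)
open import Relation.Binary.Core using (_Preserves_⟶_)
open import Relation.Binary.PropositionalEquality
open import Relation.Nullary using (Dec; does; yes; no; ¬_; ¬?; _×-dec_)
open import Relation.Nullary.Decidable using (dec-true; dec-false)
open import Relation.Unary using (Pred; Decidable; _≐_)
open import Relation.Unary.Properties using (∁?)

private
  variable
    a b p q : Level
    A : Set a
    B : Set b

module _ {P : Pred A p} (P? : Decidable P) where

  filter-partition-↭ : ∀ xs → xs ↭ filter P? xs ++ filter (∁? P?) xs
  filter-partition-↭ [] = ↭-refl
  filter-partition-↭ (x ∷ xs) with does (P? x)
  ... | true  = ↭-prep x (filter-partition-↭ xs)
  ... | false = ↭-trans (↭-prep x (filter-partition-↭ xs)) (↭-sym (shift x (filter P? xs) _))

  filter-filter : ∀ {Q : Pred A q} (Q? : Decidable Q) xs →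
                  filter Q? (filter P? xs) ≡ filter (λ x → P? x ×-dec Q? x) xs
  filter-filter Q? [] = refl
  filter-filter Q? (x ∷ xs) with P? x
  ... | no _  = filter-filter Q? xs
  ... | yes _ with Q? x
  ...   | yes _ = cong (x ∷_) (filter-filter Q? xs)
  ...   | no _  = filter-filter Q? xs

module _ {P : Pred B p} (P? : Decidable P) (f : A → B) where

  filter-map : ∀ xs → filter P? (map f xs) ≡ map f (filter (P? ∘ f) xs)
  filter-map [] = refl
  filter-map (x ∷ xs) with does (P? (f x))
  ... | true  = cong (f x ∷_) (filter-map xs)
  ... | false = filter-map xs

unique-⇔-↭ : ∀ {xs ys : List A} → Unique xs → Unique ys → (∀ {x} → x ∈ xs ⇔ x ∈ ys) → xs ↭ ys
unique-⇔-↭ xs! ys! xs⇔ys = ∼bag⇒↭ (unique∧set⇒bag xs! ys! xs⇔ys)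

count≤ : ℕ → List ℕ → ℕ
count≤ j xs = length (filter (_≤? j) xs)

count≤-accept : ∀ {j x} xs → x ≤ j → count≤ j (x ∷ xs) ≡ suc (count≤ j xs)
count≤-accept xs x≤j = cong length (filter-accept (_≤? _) x≤j)

count≤-reject : ∀ {j x} xs → x ≰ j → count≤ j (x ∷ xs) ≡ count≤ j xs
count≤-reject xs x≰j = cong length (filter-reject (_≤? _) x≰j)

count≤-none : ∀ {j} xs → All (j <_) xs → count≤ j xs ≡ 0
count≤-none xs j<xs = cong length (filter-none (_≤? _) (All.map ℕ.<⇒≱ j<xs))

count≤-map : ∀ {j} (f : A → ℕ) xs → count≤ j (map f xs) ≡ length (filter (λ x → f x ≤? j) xs)
count≤-map {j = j} f xs =
  trans (cong length (filter-map (_≤? j) f xs)) (length-map f (filter (λ x → f x ≤? j) xs))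

private
  interchange-cong : ∀ {a b c d s t u v} → a ℕ.+ c ≡ b ℕ.+ d → s ℕ.+ u ≡ t ℕ.+ v →
                     (a ℕ.+ s) ℕ.+ (c ℕ.+ u) ≡ (b ℕ.+ t) ℕ.+ (d ℕ.+ v)
  interchange-cong {a} {b} {c} {d} {s} {t} {u} {v} e₁ e₂ = begin
    (a ℕ.+ s) ℕ.+ (c ℕ.+ u) ≡⟨ interchange ℕ.+-commutativeSemigroup a s c u ⟩
    (a ℕ.+ c) ℕ.+ (s ℕ.+ u) ≡⟨ cong₂ ℕ._+_ e₁ e₂ ⟩
    (b ℕ.+ d) ℕ.+ (t ℕ.+ v) ≡⟨ interchange ℕ.+-commutativeSemigroup b d t v ⟩
    (b ℕ.+ t) ℕ.+ (d ℕ.+ v) ∎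
    where open ≡-Reasoning

sum-⊓-suc : ∀ m xs → sum (map (_⊓ suc m) xs) ℕ.+ count≤ m xs ≡ sum (map (_⊓ m) xs) ℕ.+ length xs
sum-⊓-suc m [] = refl
sum-⊓-suc m (x ∷ xs) with x ≤? m
... | yes x≤m =
  trans (cong (sum (map (_⊓ suc m) (x ∷ xs)) ℕ.+_) (count≤-accept xs x≤m))
    (interchange-cong {c = 1} {d = 1}
      (cong (ℕ._+ 1) (trans (ℕ.m≤n⇒m⊓n≡m (ℕ.m≤n⇒m≤1+n x≤m)) (sym (ℕ.m≤n⇒m⊓n≡m x≤m))))
      (sum-⊓-suc m xs))
... | no x≰m =
  trans (cong (sum (map (_⊓ suc m) (x ∷ xs)) ℕ.+_) (count≤-reject xs x≰m))
    (interchange-cong {c = 0} {d = 1} x⊓1+m≡x⊓m+1 (sum-⊓-suc m xs))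
  where
  open ≡-Reasoning
  x⊓1+m≡x⊓m+1 : x ⊓ suc m ℕ.+ 0 ≡ x ⊓ m ℕ.+ 1
  x⊓1+m≡x⊓m+1 = begin
    x ⊓ suc m ℕ.+ 0 ≡⟨ ℕ.+-identityʳ _ ⟩
    x ⊓ suc m       ≡⟨ ℕ.m≥n⇒m⊓n≡n (ℕ.≰⇒> x≰m) ⟩
    suc m           ≡⟨ ℕ.+-comm 1 m ⟩
    m ℕ.+ 1         ≡⟨ cong (ℕ._+ 1) (ℕ.m≥n⇒m⊓n≡n (ℕ.<⇒≤ (ℕ.≰⇒> x≰m))) ⟨
    x ⊓ m ℕ.+ 1     ∎

sum-⊓-zero : ∀ xs → sum (map (_⊓ 0) xs) ≡ 0
sum-⊓-zero [] = refl
sum-⊓-zero (x ∷ xs) = cong₂ ℕ._+_ (ℕ.⊓-zeroʳ x) (sum-⊓-zero xs)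

sum-⊓-≥ : ∀ {m} xs → All (_≤ m) xs → sum (map (_⊓ m) xs) ≡ sum xs
sum-⊓-≥ [] [] = refl
sum-⊓-≥ (x ∷ xs) (x≤m ∷ xs≤m) = cong₂ ℕ._+_ (ℕ.m≤n⇒m⊓n≡m x≤m) (sum-⊓-≥ xs xs≤m)

All-≤-sum : ∀ xs → All (_≤ sum xs) xs
All-≤-sum [] = []
All-≤-sum (x ∷ xs) =
  ℕ.m≤m+n x (sum xs) ∷ All.map (λ y≤ → ℕ.≤-trans y≤ (ℕ.m≤n+m (sum xs) x)) (All-≤-sum xs)

-- Σ x = Σ_m #{x > m}: compare the truncated sums Σ (x ⊓ m) by induction on m.
count≤-≥⇒sum-≤ : ∀ qs ps → length qs ≡ length ps → (∀ j → count≤ j ps ≤ count≤ j qs) →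
                 sum qs ≤ sum ps
count≤-≥⇒sum-≤ qs ps |qs|≡|ps| count≤-≥ = subst₂ _≤_
  (sum-⊓-≥ qs (All.map (λ x≤ → ℕ.≤-trans x≤ (ℕ.m≤m+n _ _)) (All-≤-sum qs)))
  (sum-⊓-≥ ps (All.map (λ x≤ → ℕ.≤-trans x≤ (ℕ.m≤n+m _ _)) (All-≤-sum ps)))
  (truncated (sum qs ℕ.+ sum ps))
  where
  open ℕ.≤-Reasoning
  truncated : ∀ m → sum (map (_⊓ m) qs) ≤ sum (map (_⊓ m) ps)
  truncated zero = ℕ.≤-reflexive (trans (sum-⊓-zero qs) (sym (sum-⊓-zero ps)))
  truncated (suc m) = ℕ.+-cancelʳ-≤ (count≤ m qs) _ _ (begin
    sum (map (_⊓ suc m) qs) ℕ.+ count≤ m qs ≡⟨ sum-⊓-suc m qs ⟩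
    sum (map (_⊓ m) qs) ℕ.+ length qs       ≤⟨ ℕ.+-mono-≤ (truncated m) (ℕ.≤-reflexive |qs|≡|ps|) ⟩
    sum (map (_⊓ m) ps) ℕ.+ length ps       ≡⟨ sum-⊓-suc m ps ⟨
    sum (map (_⊓ suc m) ps) ℕ.+ count≤ m ps ≤⟨ ℕ.+-monoʳ-≤ _ (count≤-≥ m) ⟩
    sum (map (_⊓ suc m) ps) ℕ.+ count≤ m qs ∎)

sumℚ-++ : ∀ xs ys → sumℚ (xs ++ ys) ≡ sumℚ xs +ℚ sumℚ ys
sumℚ-++ [] ys = sym (ℚ.+-identityˡ _)
sumℚ-++ (x ∷ xs) ys = trans (cong (x +ℚ_) (sumℚ-++ xs ys)) (sym (ℚ.+-assoc x _ _))

sumℚ-↭ : sumℚ Preserves _↭_ ⟶ _≡_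
sumℚ-↭ p = foldr-commMonoid (setoid ℚ) ℚ.+-0-isCommutativeMonoid (↭⇒↭ₛ p)

sumℚ-nonneg : ∀ {xs} → All (0ℚ ≤ℚ_) xs → 0ℚ ≤ℚ sumℚ xs
sumℚ-nonneg [] = ℚ.≤-refl
sumℚ-nonneg (x≥0 ∷ xs≥0) = ℚ.+-mono-≤ x≥0 (sumℚ-nonneg xs≥0)

module _ {P : Pred A p} {Q : Pred A q} (f : A → ℚ) (P? : Decidable P) (Q? : Decidable Q) where

  sumℚ-filter-partition : ∀ xs →
    sumℚ (map f (filter P? xs)) ≡
    sumℚ (map f (filter (λ x → P? x ×-dec Q? x) xs)) +ℚ
    sumℚ (map f (filter (λ x → P? x ×-dec ¬? (Q? x)) xs))
  sumℚ-filter-partition xs = begin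
    sumℚ (map f (filter P? xs))
      ≡⟨ sumℚ-↭ (↭-map⁺ f (filter-partition-↭ Q? (filter P? xs))) ⟩
    sumℚ (map f (filter Q? (filter P? xs) ++ filter (∁? Q?) (filter P? xs)))
      ≡⟨ cong sumℚ (map-++ f (filter Q? (filter P? xs)) _) ⟩
    sumℚ (map f (filter Q? (filter P? xs)) ++ map f (filter (∁? Q?) (filter P? xs)))
      ≡⟨ sumℚ-++ (map f (filter Q? (filter P? xs))) _ ⟩
    sumℚ (map f (filter Q? (filter P? xs))) +ℚ sumℚ (map f (filter (∁? Q?) (filter P? xs)))
      ≡⟨ cong₂ (λ ys zs → sumℚ (map f ys) +ℚ sumℚ (map f zs))
           (filter-filter P? Q? xs) (filter-filter P? (∁? Q?) xs) ⟩
    sumℚ (map f (filter (λ x → P? x ×-dec Q? x) xs)) +ℚ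
    sumℚ (map f (filter (λ x → P? x ×-dec ¬? (Q? x)) xs)) ∎
    where open ≡-Reasoning

sumℚ-take-≤ : ∀ t {xs ys} → AllPairs _≤ℚ_ xs → All (0ℚ ≤ℚ_) ys → ys ⊆ xs → t ≤ length ys →
              sumℚ (take t xs) ≤ℚ sumℚ ys
sumℚ-take-≤ zero _ ys≥0 _ _ = sumℚ-nonneg ys≥0
sumℚ-take-≤ (suc t) {x ∷ _} (_ ∷ sorted) (_ ∷ ys≥0) (refl ∷ ys⊆xs) (s≤s t≤) =
  ℚ.+-monoʳ-≤ x (sumℚ-take-≤ t sorted ys≥0 ys⊆xs t≤)
sumℚ-take-≤ (suc t) (x≤xs ∷ sorted) (_ ∷ ys≥0) (_ ∷ʳ y∷ys⊆xs) (s≤s t≤) =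
  ℚ.+-mono-≤ (All.lookup x≤xs (Any-resp-⊆ y∷ys⊆xs (here refl)))
             (sumℚ-take-≤ t sorted ys≥0 (∷ˡ⁻ y∷ys⊆xs) t≤)

module _ {n : ℕ} where

  ↭-filter-allFin : ∀ {o} {Q : Pred (Fin n) p} (Q? : Decidable Q) → Unique o → (∀ i → i ∈ o ⇔ Q i) →
                    o ↭ filter Q? (allFin n)
  ↭-filter-allFin Q? o! o⇔Q = unique-⇔-↭ o! (Unique-filter⁺ Q? (allFin⁺ n)) λ {i} → mk⇔
    (λ i∈o → ∈-filter⁺ Q? {xs = allFin n} (∈-allFin i) (Equivalence.to (o⇔Q i) i∈o))
    (λ i∈filter → Equivalence.from (o⇔Q i) (proj₂ (∈-filter⁻ Q? {xs = allFin n} i∈filter)))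

  open DecMembership (_≟ᶠ_ {n}) using (_∈?_)

  Cost-split : ∀ f {o} → Unique o →
               Cost n f ≡ sum (map f o) ℕ.+ sum (map f (filter (λ i → ¬? (i ∈? o)) (allFin n)))
  Cost-split f {o} o! = begin
    sum (map f (allFin n))                ≡⟨ sum-↭ (↭-map⁺ f allFin↭) ⟩
    sum (map f (o ++ outside))            ≡⟨ cong sum (map-++ f o outside) ⟩
    sum (map f o ++ map f outside)        ≡⟨ sum-++ (map f o) _ ⟩
    sum (map f o) ℕ.+ sum (map f outside) ∎
    where
    open ≡-Reasoning
    outside : List (Fin n)
    outside = filter (λ i → ¬? (i ∈? o)) (allFin n)
    allFin↭ : allFin n ↭ o ++ outside
    allFin↭ = ↭-trans (filter-partition-↭ (_∈? o) (allFin n))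
                (++⁺ʳ outside (↭-sym (↭-filter-allFin (_∈? o) o! (λ i → ⇔-id (i ∈ o)))))

  Cost-≤ : ∀ f g {o} → Unique o → (∀ i → i ∉ o → f i ≡ g i) → sum (map f o) ≤ sum (map g o) →
           Cost n f ≤ Cost n g
  Cost-≤ f g {o} o! f≡g f≤g = begin
    Cost n f                              ≡⟨ Cost-split f o! ⟩
    sum (map f o) ℕ.+ sum (map f outside) ≡⟨ cong (λ ys → sum (map f o) ℕ.+ sum ys)
                                               (map-cong-local (All.map (f≡g _) (all-filter _ (allFin n)))) ⟩
    sum (map f o) ℕ.+ sum (map g outside) ≤⟨ ℕ.+-monoˡ-≤ _ f≤g ⟩
    sum (map g o) ℕ.+ sum (map g outside) ≡⟨ Cost-split g o! ⟨
    Cost n g                              ∎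
    where
    open ℕ.≤-Reasoning
    outside : List (Fin n)
    outside = filter (λ i → ¬? (i ∈? o)) (allFin n)

module NextFit (L : ℕ → ℚ) where

  room : ℕ → ℚ
  room zero    = 0ℚ
  room (suc j) = room j +ℚ (1ℚ - L (suc j))

  nextFit : ℕ → ℚ → List ℚ → List ℕ
  nextFit c load [] = []
  nextFit c load (x ∷ xs) =
    c ∷ (if does (1ℚ ℚ.<? load +ℚ x) then nextFit (suc c) (L (suc c)) xs else nextFit c (load +ℚ x) xs)

  nextFit-close : ∀ {c load x} xs → 1ℚ <ℚ load +ℚ x →
                  nextFit c load (x ∷ xs) ≡ c ∷ nextFit (suc c) (L (suc c)) xs
  nextFit-close xs over = cong (_ ∷_) (if-cong (dec-true (1ℚ ℚ.<? _) over))

  nextFit-keep : ∀ {c load x} xs → ¬ 1ℚ <ℚ load +ℚ x →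
                 nextFit c load (x ∷ xs) ≡ c ∷ nextFit c (load +ℚ x) xs
  nextFit-keep xs fits = cong (_ ∷_) (if-cong (dec-false (1ℚ ℚ.<? _) fits))

  nextFit-≥ : ∀ c load xs → All (c ≤_) (nextFit c load xs)
  nextFit-≥ c load [] = []
  nextFit-≥ c load (x ∷ xs) with 1ℚ ℚ.<? load +ℚ x
  ... | yes over = subst (All (c ≤_)) (sym (nextFit-close {c} {load} {x} xs over))
                     (ℕ.≤-refl ∷ All.map (ℕ.≤-trans (ℕ.n≤1+n c)) (nextFit-≥ (suc c) _ xs))
  ... | no fits  = subst (All (c ≤_)) (sym (nextFit-keep {c} {load} {x} xs fits))
                     (ℕ.≤-refl ∷ nextFit-≥ c _ xs)

  data Overfills (j : ℕ) (D : ℚ) (xs : List ℚ) (t : ℕ) : Set where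
    exhausted : t ≡ length xs → Overfills j D xs t
    overflow  : room j <ℚ D +ℚ sumℚ (take t xs) → Overfills j D xs t

  Overfills-∷ : ∀ {j D x xs t} → Overfills j (D +ℚ x) xs t → Overfills j D (x ∷ xs) (suc t)
  Overfills-∷ (exhausted t≡|xs|) = exhausted (cong suc t≡|xs|)
  Overfills-∷ {j} {D} {x} {xs} {t} (overflow over) =
    overflow (subst (room j <ℚ_) (ℚ.+-assoc D x (sumℚ (take t xs))) over)

  private
    open +-*-Solver
    open ℚ.≤-Reasoning

    closed-room-< : ∀ c load D x → room c +ℚ load ≤ℚ D +ℚ L (suc c) → 1ℚ <ℚ load +ℚ x →
                    room (suc c) <ℚ D +ℚ x
    closed-room-< c load D x inv over = begin-strict
      room c +ℚ (1ℚ - L (suc c))          <⟨ ℚ.+-monoʳ-< (room c) (ℚ.+-monoˡ-< (ℚ.- L (suc c)) over) ⟩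
      room c +ℚ ((load +ℚ x) - L (suc c)) ≡⟨ solve 4 (λ r l x b → r :+ ((l :+ x) :- b) := ((r :+ l) :+ x) :- b)
                                               refl (room c) load x (L (suc c)) ⟩
      ((room c +ℚ load) +ℚ x) - L (suc c) ≤⟨ ℚ.+-monoˡ-≤ (ℚ.- L (suc c)) (ℚ.+-monoˡ-≤ x inv) ⟩
      ((D +ℚ L (suc c)) +ℚ x) - L (suc c) ≡⟨ solve 3 (λ d x b → ((d :+ b) :+ x) :- b := d :+ x)
                                               refl D x (L (suc c)) ⟩
      D +ℚ x                              ∎

    kept-load : ∀ c load D x → room c +ℚ load ≤ℚ D +ℚ L (suc c) →
                room c +ℚ (load +ℚ x) ≤ℚ (D +ℚ x) +ℚ L (suc c)
    kept-load c load D x inv = begin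
      room c +ℚ (load +ℚ x) ≡⟨ ℚ.+-assoc (room c) load x ⟨
      (room c +ℚ load) +ℚ x ≤⟨ ℚ.+-monoˡ-≤ x inv ⟩
      (D +ℚ L (suc c)) +ℚ x ≡⟨ solve 3 (λ d b x → (d :+ b) :+ x := (d :+ x) :+ b) refl D (L (suc c)) x ⟩
      (D +ℚ x) +ℚ L (suc c) ∎

  -- Bin suc c is open with weight load, and D is the weight of the items packed so far.
  -- Bins 1 … c were closed only after overflowing; the invariant records that their
  -- room plus the weight added to the open bin so far is at most D.
  nextFit-overfills : ∀ {j} xs c load D → c < j → room c +ℚ load ≤ℚ D +ℚ L (suc c) →
                      Overfills j D xs (count≤ j (nextFit (suc c) load xs))
  nextFit-overfills [] c load D c<j inv = exhausted refl
  nextFit-overfills {j} (x ∷ xs) c load D c<j inv with 1ℚ ℚ.<? load +ℚ x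
  ... | yes over = subst (Overfills j D (x ∷ xs)) (sym count-eq) (closing (ℕ.m≤n⇒m<n∨m≡n c<j))
    where
    rest : List ℕ
    rest = nextFit (suc (suc c)) (L (suc (suc c))) xs
    count-eq : count≤ j (nextFit (suc c) load (x ∷ xs)) ≡ suc (count≤ j rest)
    count-eq = trans (cong (count≤ j) (nextFit-close {suc c} {load} {x} xs over)) (count≤-accept rest c<j)
    closing : suc c < j ⊎ suc c ≡ j → Overfills j D (x ∷ xs) (suc (count≤ j rest))
    closing (inj₁ sc<j) = Overfills-∷ (nextFit-overfills xs (suc c) _ (D +ℚ x) sc<j
                            (ℚ.+-monoˡ-≤ _ (ℚ.<⇒≤ (closed-room-< c load D x inv over))))
    closing (inj₂ sc≡j) = subst (λ t → Overfills j D (x ∷ xs) (suc t))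
      (sym (count≤-none rest (subst (λ i → All (i <_) rest) sc≡j (nextFit-≥ (suc (suc c)) _ xs))))
      (overflow (subst₂ (λ i y → room i <ℚ D +ℚ y) sc≡j (sym (ℚ.+-identityʳ x))
                  (closed-room-< c load D x inv over)))
  ... | no fits = subst (Overfills j D (x ∷ xs)) (sym count-eq)
                    (Overfills-∷ (nextFit-overfills xs c (load +ℚ x) (D +ℚ x) c<j (kept-load c load D x inv)))
    where
    count-eq : count≤ j (nextFit (suc c) load (x ∷ xs)) ≡ suc (count≤ j (nextFit (suc c) (load +ℚ x) xs))
    count-eq = trans (cong (count≤ j) (nextFit-keep {suc c} {load} {x} xs fits)) (count≤-accept _ c<j)

module _ {n : ℕ} (w : Fin n → ℚ) (L : ℕ → ℚ) (base : Fin n → ℕ) where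
  open NextFit L

  nfi-skip : ∀ {c load s ss i} → i ≢ s →
             nfi n w L base c load (s ∷ ss) i ≡
             (if does (1ℚ ℚ.<? load +ℚ w s) then nfi n w L base (suc c) (L (suc c)) ss i
                                           else nfi n w L base c (load +ℚ w s) ss i)
  nfi-skip {s = s} {i = i} i≢s = if-cong (dec-false (i ≟ᶠ s) i≢s)

  nfi-∉ : ∀ c load ss i → i ∉ ss → nfi n w L base c load ss i ≡ base i
  nfi-∉ c load [] i i∉ = refl
  nfi-∉ c load (s ∷ ss) i i∉ =
    trans (nfi-skip {c} {load} {s} {ss} (i∉ ∘ here)) (next (1ℚ ℚ.<? load +ℚ w s))
    where
    next : (d : Dec (1ℚ <ℚ load +ℚ w s)) →
           (if does d then nfi n w L base (suc c) (L (suc c)) ss i else nfi n w L base c (load +ℚ w s) ss i) ≡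
           base i
    next (yes _) = nfi-∉ (suc c) (L (suc c)) ss i (i∉ ∘ there)
    next (no _)  = nfi-∉ c (load +ℚ w s) ss i (i∉ ∘ there)

  nfi-on-order : ∀ c load ss → Unique ss → map (nfi n w L base c load ss) ss ≡ nextFit c load (map w ss)
  nfi-on-order c load [] [] = refl
  nfi-on-order c load (s ∷ ss) (s∉ss ∷ ss!) = cong₂ _∷_
    (if-cong (dec-true (s ≟ᶠ s) refl))
    (trans (map-cong-local (All.map (λ s≢i → nfi-skip {c} {load} {s} {ss} (s≢i ∘ sym)) s∉ss))
           (next (1ℚ ℚ.<? load +ℚ w s)))
    where
    next : (d : Dec (1ℚ <ℚ load +ℚ w s)) →
           map (λ i → if does d then nfi n w L base (suc c) (L (suc c)) ss i
                                else nfi n w L base c (load +ℚ w s) ss i) ss ≡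
           (if does d then nextFit (suc c) (L (suc c)) (map w ss) else nextFit c (load +ℚ w s) (map w ss))
    next (yes _) = nfi-on-order (suc c) (L (suc c)) ss ss!
    next (no _)  = nfi-on-order c (load +ℚ w s) ss ss!

module _ (k : ℕ) .{{_ : NonZero k}} {n : ℕ} (w : Fin n → ℚ) (P : Packing n) where

  small? : Decidable (λ i → Small k (w i))
  small? i = w i ℚ.≤? epsSq k

  open NextFit (largeWeight n k w P)

  binWeight-partition : ∀ b →
    binWeight n w P b ≡
    sumℚ (map w (filter (λ i → (P i ℕ.≟ b) ×-dec small? i) (allFin n))) +ℚ largeWeight n k w P b
  binWeight-partition b = sumℚ-filter-partition w (λ i → P i ℕ.≟ b) small? (allFin n)

  smallWeight-≤-room : ValidIndices n P → Feasible n w P → ∀ j →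
    sumℚ (map w (filter (λ i → small? i ×-dec P i ≤? j) (allFin n))) ≤ℚ room j
  smallWeight-≤-room indices feasible zero = ℚ.≤-reflexive (cong (sumℚ ∘ map w)
    (filter-none (λ i → small? i ×-dec P i ≤? 0) {allFin n}
      (All.tabulate (λ {i} _ (_ , Pi≤0) → ℕ.<⇒≱ (indices i) Pi≤0))))
  smallWeight-≤-room indices feasible (suc j) = begin
    sumℚ (map w (filter (λ i → small? i ×-dec P i ≤? suc j) (allFin n)))
      ≡⟨ sumℚ-filter-partition w (λ i → small? i ×-dec P i ≤? suc j) (λ i → P i ≤? j) (allFin n) ⟩
    sumℚ (map w (filter (λ i → (small? i ×-dec P i ≤? suc j) ×-dec P i ≤? j) (allFin n))) +ℚ
    sumℚ (map w (filter (λ i → (small? i ×-dec P i ≤? suc j) ×-dec ¬? (P i ≤? j)) (allFin n)))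
      ≡⟨ cong₂ (λ xs ys → sumℚ (map w xs) +ℚ sumℚ (map w ys))
           (filter-≐ _ (λ i → small? i ×-dec P i ≤? j) inEarlierBins (allFin n))
           (filter-≐ _ (λ i → (P i ℕ.≟ suc j) ×-dec small? i) inLastBin (allFin n)) ⟩
    sumℚ (map w (filter (λ i → small? i ×-dec P i ≤? j) (allFin n))) +ℚ smallInLastBin
      ≤⟨ ℚ.+-mono-≤ (smallWeight-≤-room indices feasible j) smallInLastBin-≤ ⟩
    room j +ℚ (1ℚ - largeInLastBin) ∎
    where
    open ℚ.≤-Reasoning
    inEarlierBins : (λ i → (Small k (w i) × P i ≤ suc j) × P i ≤ j) ≐ (λ i → Small k (w i) × P i ≤ j)
    inEarlierBins = (λ ((s , _) , Pi≤j) → s , Pi≤j) , (λ (s , Pi≤j) → (s , ℕ.m≤n⇒m≤1+n Pi≤j) , Pi≤j)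
    inLastBin : (λ i → (Small k (w i) × P i ≤ suc j) × P i ≰ j) ≐ (λ i → P i ≡ suc j × Small k (w i))
    inLastBin = (λ ((s , Pi≤1+j) , Pi≰j) → ℕ.≤-antisym Pi≤1+j (ℕ.≰⇒> Pi≰j) , s)
              , (λ (Pi≡1+j , s) → (s , ℕ.≤-reflexive Pi≡1+j) , ℕ.<⇒≱ (ℕ.≤-reflexive (sym Pi≡1+j)))
    smallInLastBin largeInLastBin : ℚ
    smallInLastBin = sumℚ (map w (filter (λ i → (P i ℕ.≟ suc j) ×-dec small? i) (allFin n)))
    largeInLastBin = largeWeight n k w P (suc j)
    smallInLastBin-≤ : smallInLastBin ≤ℚ 1ℚ - largeInLastBin
    smallInLastBin-≤ = begin
      smallInLastBin                                      ≡⟨ solve 2 (λ s l → s := (s :+ l) :- l)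
                                                              refl smallInLastBin largeInLastBin ⟩
      (smallInLastBin +ℚ largeInLastBin) - largeInLastBin ≤⟨ ℚ.+-monoˡ-≤ (ℚ.- largeInLastBin)
                                                              (subst (_≤ℚ 1ℚ) (binWeight-partition (suc j))
                                                                (feasible (suc j))) ⟩
      1ℚ - largeInLastBin                                 ∎
      where open +-*-Solver

  count≤-dominated : ValidWeights n w → ValidIndices n P → Feasible n w P →
    ∀ {o} → Unique o → (∀ i → i ∈ o ⇔ Small k (w i)) → Linked (λ x y → w x ≤ℚ w y) o →
    ∀ j → count≤ j (map P o) ≤ count≤ j (nextFit 1 (largeWeight n k w P 1) (map w o))
  count≤-dominated weights indices feasible {o} o! o⇔small sorted zero =
    ℕ.≤-trans (ℕ.≤-reflexive (count≤-none (map P o) (All-map⁺ (All.tabulate (λ {i} _ → indices i)))))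
              z≤n
  count≤-dominated weights indices feasible {o} o! o⇔small sorted (suc j) =
    bounded (nextFit-overfills (map w o) 0 (largeWeight n k w P 1) 0ℚ (s≤s z≤n) ℚ.≤-refl)
    where
    inFirstBins : List (Fin n)
    inFirstBins = filter (λ i → P i ≤? suc j) o

    lightest-≤-room : ∀ {t} → t < count≤ (suc j) (map P o) →
                      0ℚ +ℚ sumℚ (take t (map w o)) ≤ℚ room (suc j)
    lightest-≤-room {t} t<count = begin
      0ℚ +ℚ sumℚ (take t (map w o))
        ≡⟨ ℚ.+-identityˡ _ ⟩
      sumℚ (take t (map w o))
        ≤⟨ sumℚ-take-≤ t (Linked⇒AllPairs ℚ.≤-trans (Linked-map⁺ sorted))
             (All-map⁺ (All.tabulate (λ {i} _ → ℚ.<⇒≤ (proj₁ (weights i)))))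
             (⊆-map⁺ w (filter-⊆ (λ i → P i ≤? suc j) o))
             (ℕ.<⇒≤ (subst (t <_) (trans (count≤-map P o) (sym (length-map w inFirstBins))) t<count)) ⟩
      sumℚ (map w inFirstBins)
        ≡⟨ sumℚ-↭ (↭-map⁺ w (filter-↭ (λ i → P i ≤? suc j) (↭-filter-allFin small? o! o⇔small))) ⟩
      sumℚ (map w (filter (λ i → P i ≤? suc j) (filter small? (allFin n))))
        ≡⟨ cong (sumℚ ∘ map w) (filter-filter small? (λ i → P i ≤? suc j) (allFin n)) ⟩
      sumℚ (map w (filter (λ i → small? i ×-dec P i ≤? suc j) (allFin n)))
        ≤⟨ smallWeight-≤-room indices feasible (suc j) ⟩
      room (suc j) ∎
      where open ℚ.≤-Reasoning

    bounded : ∀ {t} → Overfills (suc j) 0ℚ (map w o) t → count≤ (suc j) (map P o) ≤ t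
    bounded {t} (exhausted t≡|o|) = begin
      count≤ (suc j) (map P o) ≤⟨ length-filter (_≤? suc j) (map P o) ⟩
      length (map P o)         ≡⟨ length-map P o ⟩
      length o                 ≡⟨ length-map w o ⟨
      length (map w o)         ≡⟨ t≡|o| ⟨
      t                        ∎
      where open ℕ.≤-Reasoning
    bounded (overflow over) =
      ℕ.≮⇒≥ λ t<count → ℚ.<-irrefl refl (ℚ.<-≤-trans over (lightest-≤-room t<count))

mainTheorem5 : (k : ℕ) → .{{_ : NonZero k}} → 4 ≤ k →
    (n : ℕ) → (w : Fin n → ℚ) → ValidWeights n w →
    (P : Packing n) → ValidIndices n P → Feasible n w P →
    (order : List (Fin n)) → SmallOrder n k w order →
    Cost n (QP n k w P order) ≤ Cost n P
mainTheorem5 k _ n w weights P indices feasible order (order! , order⇔small , sorted) =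
  Cost-≤ (QP n k w P order) P order! (λ i → nfi-∉ w L P 1 (L 1) order i)
    (count≤-≥⇒sum-≤ (map (QP n k w P order) order) (map P order)
      (trans (length-map _ order) (sym (length-map P order)))
      λ j → subst (λ qs → count≤ j (map P order) ≤ count≤ j qs)
              (sym (nfi-on-order w L P 1 (L 1) order order!))
              (count≤-dominated k w P weights indices feasible order! order⇔small sorted j))
  where
  L : ℕ → ℚ
  L = largeWeight n k w P
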